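{- For integers $n,k\geq 0$ and $s\geq 1$, \[ M_{k}^{(s)}(\underbrace{1,1,\ldots ,1}_{n \text{ times}})=\sum_{j=0}^{\lfloor k/(s+1)\rfloor }\binom{n}{k-j(s+1)}\binom{j+n-1}{n-1}. \]
   Context: $M_{k}^{(s)}(x_{1},\ldots,x_{n})=\sum x_{1}^{a_{1}}\cdots x_{n}^{a_{n}}$, the sum over all $n$-tuples of nonnegative integers $(a_1,\dots,a_n)$ with $a_1+\cdots+a_n=k$ and each $a_i\equiv 0$ or $1 \pmod{s+1}$; for $n=0$ it equals $\delta_{k,0}$. -}

module Defs where

open import Data.Nat using (ℕ; zero; suc; _+_; _*_; _∸_; _^_; _≡ᵇ_)
open import Data.Nat.DivMod using (_%_; _/_)
open import Data.Nat.Combinatorics using (_C_)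
open import Data.Bool using (Bool; true; false; _∧_; _∨_)
open import Data.List using (List; []; _∷_; map; concatMap; filterᵇ; upTo)
open import Data.Nat.ListAction using (sum)
open import Data.Vec using (Vec; []; _∷_; foldr; zipWith)

tuplesUpTo : (n k : ℕ) → List (Vec ℕ n)
tuplesUpTo zero    k = [] ∷ []
tuplesUpTo (suc n) k = concatMap (λ a → map (a ∷_) (tuplesUpTo n k)) (upTo (suc k))

vsum : ∀ {n} → Vec ℕ n → ℕ
vsum = foldr _ _+_ 0

vprod : ∀ {n} → Vec ℕ n → ℕ
vprod = foldr _ _*_ 1

admissible : (s a : ℕ) → Bool
admissible s a = ((a % suc s) ≡ᵇ 0) ∨ ((a % suc s) ≡ᵇ 1)

allAdmissible : ∀ {n} → (s : ℕ) → Vec ℕ n → Bool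
allAdmissible s = foldr _ (λ a b → admissible s a ∧ b) true

-- M_k^{(s)}(x_1,…,x_n) = Σ x_1^{a_1} ⋯ x_n^{a_n} over n-tuples (a_1,…,a_n) of
-- nonnegative integers with a_1+⋯+a_n = k and each a_i ≡ 0 or 1 (mod s+1).
-- (Any such tuple has all entries ≤ k, so enumerating tuplesUpTo n k suffices.)
-- Evaluated at natural-number arguments.
M : (s k : ℕ) → ∀ {n} → Vec ℕ n → ℕ
M s k {n} x =
  sum (map (λ a → vprod (zipWith _^_ x a))
           (filterᵇ (λ a → (vsum a ≡ᵇ k) ∧ allAdmissible s a) (tuplesUpTo n k)))

ones : (n : ℕ) → Vec ℕ n
ones zero    = []
ones (suc n) = 1 ∷ ones n

-- binom(j+n-1, n-1), with the standard convention binom(j-1,-1) = δ_{j,0}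
-- in the case n = 0 (the only reading making the identity hold for n = 0).
binomShift : (j n : ℕ) → ℕ
binomShift zero    zero    = 1
binomShift (suc j) zero    = 0
binomShift j       (suc n) = (j + n) C n

sumTo : ℕ → (ℕ → ℕ) → ℕ
sumTo m f = sum (map f (upTo (suc m)))

-- At (1,…,1) every monomial is 1, so M_k^{(s)}(1ⁿ) counts tuples: it is the coefficient of xᵏ
-- in ((1 + x)/(1 − xᵗ))ⁿ, t = s + 1, since the admissible exponents 0, 1, t, t + 1, 2t, … have
-- generating series (1 + x)/(1 − xᵗ).  Expanding (1 + x)ⁿ · (1 − xᵗ)⁻ⁿ gives the right-hand side.
-- Rather than multiplying series, both sides are shown to satisfy the coefficientwise form of
-- (1 − xᵗ) X_{n+1} = (1 + x) X_n with X₀ = 1, which determines them.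
module Submission where

open import Defs
open import Data.Nat using (ℕ; zero; suc; _+_; _*_; _∸_; _≤_; _<_; z≤n; s≤s; _≡ᵇ_; _^_)
open import Data.Nat.Properties
open import Data.Nat.DivMod using (_/_; _%_; m<n⇒m%n≡m; [m+n]%n≡m%n; m≡m%n+[m/n]*n; m%n<n; m/n≤m; m/n*n≤m)
open import Data.Nat.Combinatorics using (_C_; nCk+nC[k+1]≡[n+1]C[k+1]; nCn≡1; k>n⇒nCk≡0)
open import Data.Nat.Induction using (<-rec)
open import Data.Nat.ListAction using (sum)
open import Data.Nat.ListAction.Properties using (sum-++)
open import Data.Bool using (Bool; true; false; _∧_; _∨_)
open import Data.List using (List; []; _∷_; _++_; map; concatMap; filterᵇ; applyUpTo; upTo)
open import Data.List.Properties using (map-++; map-∘; map-cong)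
open import Data.Vec using (Vec; []; _∷_; foldr; zipWith)
open import Function using (_∘_)
open import Algebra.Properties.CommutativeSemigroup +-commutativeSemigroup using (interchange)
open import Relation.Binary.PropositionalEquality
open ≡-Reasoning

∑< : ℕ → (ℕ → ℕ) → ℕ
∑< zero    f = 0
∑< (suc N) f = f 0 + ∑< N (f ∘ suc)

syntax ∑< N (λ i → e) = ∑[ i < N ] e

∑-cong : ∀ N {f g} → (∀ i → i < N → f i ≡ g i) → ∑< N f ≡ ∑< N g
∑-cong zero    eq = refl
∑-cong (suc N) eq = cong₂ _+_ (eq 0 (s≤s z≤n)) (∑-cong N (λ i i<N → eq (suc i) (s≤s i<N)))

∑-truncate : ∀ {b N} f → b ≤ N → (∀ i → b ≤ i → i < N → f i ≡ 0) → ∑< N f ≡ ∑< b f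
∑-truncate {zero}  {zero}  f _         _      = refl
∑-truncate {zero}  {suc N} f _         vanish =
  cong₂ _+_ (vanish 0 z≤n (s≤s z≤n))
            (∑-truncate (f ∘ suc) z≤n (λ i _ i<N → vanish (suc i) z≤n (s≤s i<N)))
∑-truncate {suc b} {suc N} f (s≤s b≤N) vanish =
  cong (f 0 +_) (∑-truncate (f ∘ suc) b≤N (λ i b≤i i<N → vanish (suc i) (s≤s b≤i) (s≤s i<N)))

∑-distrib-+ : ∀ N f g → ∑[ i < N ] (f i + g i) ≡ ∑< N f + ∑< N g
∑-distrib-+ zero    f g = refl
∑-distrib-+ (suc N) f g =
  trans (cong (f 0 + g 0 +_) (∑-distrib-+ N (f ∘ suc) (g ∘ suc))) (interchange (f 0) (g 0) _ _)

sum-map-applyUpTo : ∀ {A : Set} (f : A → ℕ) (g : ℕ → A) N → sum (map f (applyUpTo g N)) ≡ ∑< N (f ∘ g)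
sum-map-applyUpTo f g zero    = refl
sum-map-applyUpTo f g (suc N) = cong (f (g 0) +_) (sum-map-applyUpTo f (g ∘ suc) N)

sum-map-upTo : ∀ (f : ℕ → ℕ) N → sum (map f (upTo N)) ≡ ∑< N f
sum-map-upTo f = sum-map-applyUpTo f (λ i → i)

sum-map-concatMap : ∀ {A B : Set} (h : B → ℕ) (f : A → List B) xs →
  sum (map h (concatMap f xs)) ≡ sum (map (λ x → sum (map h (f x))) xs)
sum-map-concatMap h f []       = refl
sum-map-concatMap h f (x ∷ xs) = begin
  sum (map h (f x ++ concatMap f xs))          ≡⟨ cong sum (map-++ h (f x) _) ⟩
  sum (map h (f x) ++ map h (concatMap f xs))  ≡⟨ sum-++ (map h (f x)) _ ⟩
  sum (map h (f x)) + sum (map h (concatMap f xs))       ≡⟨ cong (_ +_) (sum-map-concatMap h f xs) ⟩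
  sum (map h (f x)) + sum (map (λ y → sum (map h (f y))) xs) ∎

sum-map-*ˡ : ∀ {A : Set} a (f : A → ℕ) xs → sum (map (λ x → a * f x) xs) ≡ a * sum (map f xs)
sum-map-*ˡ a f []       = sym (*-zeroʳ a)
sum-map-*ˡ a f (x ∷ xs) = trans (cong (a * f x +_) (sum-map-*ˡ a f xs)) (sym (*-distribˡ-+ a (f x) _))

iverson : Bool → ℕ
iverson true  = 1
iverson false = 0

sum-map-filterᵇ : ∀ {A : Set} (g : A → ℕ) (p : A → Bool) xs → (∀ x → g x ≡ 1) →
  sum (map g (filterᵇ p xs)) ≡ sum (map (iverson ∘ p) xs)
sum-map-filterᵇ g p []       _    = refl
sum-map-filterᵇ g p (x ∷ xs) g≡1 with p x
... | true  = cong₂ _+_ (g≡1 x) (sum-map-filterᵇ g p xs g≡1)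
... | false = sum-map-filterᵇ g p xs g≡1

-- shift c f is the coefficient sequence of xᶜ · ∑ f k xᵏ: it is f (k ∸ c) for c ≤ k and 0 below c.
shift : ℕ → (ℕ → ℕ) → ℕ → ℕ
shift zero    f k       = f k
shift (suc c) f zero    = 0
shift (suc c) f (suc k) = shift c f k

shift-≥ : ∀ c f {k} → c ≤ k → shift c f k ≡ f (k ∸ c)
shift-≥ zero    f _         = refl
shift-≥ (suc c) f (s≤s c≤k) = shift-≥ c f c≤k

shift-< : ∀ c f {k} → k < c → shift c f k ≡ 0
shift-< (suc c) f {zero}  _         = refl
shift-< (suc c) f {suc k} (s≤s k<c) = shift-< c f k<c

shift-cong : ∀ c {f g} k → (∀ m → c + m ≤ k → f m ≡ g m) → shift c f k ≡ shift c g k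
shift-cong zero    k       eq = eq k ≤-refl
shift-cong (suc c) zero    eq = refl
shift-cong (suc c) (suc k) eq = shift-cong c k (λ m c+m≤k → eq m (s≤s c+m≤k))

shift-cong< : ∀ c {f g} k → (∀ m → m < k → f m ≡ g m) → shift (suc c) f k ≡ shift (suc c) g k
shift-cong< c zero    eq = refl
shift-cong< c (suc k) eq = shift-cong c k (λ m c+m≤k → eq m (s≤s (m+n≤o⇒n≤o c c+m≤k)))

shift-shift : ∀ c d f k → shift c (shift d f) k ≡ shift (c + d) f k
shift-shift zero    d f k       = refl
shift-shift (suc c) d f zero    = refl
shift-shift (suc c) d f (suc k) = shift-shift c d f k

shift-comm : ∀ c d f k → shift c (shift d f) k ≡ shift d (shift c f) k
shift-comm c d f k = begin
  shift c (shift d f) k ≡⟨ shift-shift c d f k ⟩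
  shift (c + d) f k     ≡⟨ cong (λ e → shift e f k) (+-comm c d) ⟩
  shift (d + c) f k     ≡⟨ shift-shift d c f k ⟨
  shift d (shift c f) k ∎

shift-zero : ∀ c k → shift c (λ _ → 0) k ≡ 0
shift-zero zero    k       = refl
shift-zero (suc c) zero    = refl
shift-zero (suc c) (suc k) = shift-zero c k

shift-+ : ∀ c f g k → shift c (λ m → f m + g m) k ≡ shift c f k + shift c g k
shift-+ zero    f g k       = refl
shift-+ (suc c) f g zero    = refl
shift-+ (suc c) f g (suc k) = shift-+ c f g k

shift-*ʳ : ∀ c f a k → shift c (λ m → f m * a) k ≡ shift c f k * a
shift-*ʳ zero    f a k       = refl
shift-*ʳ (suc c) f a zero    = refl
shift-*ʳ (suc c) f a (suc k) = shift-*ʳ c f a k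

shift-∑ : ∀ c N (F : ℕ → ℕ → ℕ) k → shift c (λ m → ∑[ i < N ] F i m) k ≡ ∑[ i < N ] shift c (F i) k
shift-∑ c zero    F k = shift-zero c k
shift-∑ c (suc N) F k =
  trans (shift-+ c (F 0) _ k) (cong (shift c (F 0) k +_) (shift-∑ c N (F ∘ suc) k))

shift-sum-map : ∀ {A : Set} c (F : A → ℕ → ℕ) xs k →
  shift c (λ m → sum (map (λ x → F x m) xs)) k ≡ sum (map (λ x → shift c (F x) k) xs)
shift-sum-map c F []       k = shift-zero c k
shift-sum-map c F (x ∷ xs) k =
  trans (shift-+ c (F x) _ k) (cong (shift c (F x) k +_) (shift-sum-map c F xs k))

δ₀ : ℕ → ℕ
δ₀ zero    = 1
δ₀ (suc _) = 0

infixl 7 _⋆_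
infixl 8 _⋆^_

_⋆_ : (ℕ → ℕ) → (ℕ → ℕ) → ℕ → ℕ
(w ⋆ f) k = ∑[ a < suc k ] (w a * f (k ∸ a))

_⋆^_ : (ℕ → ℕ) → ℕ → ℕ → ℕ
w ⋆^ zero  = δ₀
w ⋆^ suc n = w ⋆ w ⋆^ n

⋆-unfold : ∀ w f k → (w ⋆ f) k ≡ w 0 * f k + shift 1 ((w ∘ suc) ⋆ f) k
⋆-unfold w f zero    = refl
⋆-unfold w f (suc k) = refl

⋆-split : ∀ c w f k →
  (w ⋆ f) k ≡ ∑[ i < c ] shift i (λ m → w i * f m) k + shift c ((w ∘ (c +_)) ⋆ f) k
⋆-split zero    w f k = refl
⋆-split (suc c) w f k = begin
  (w ⋆ f) k
    ≡⟨ ⋆-unfold w f k ⟩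
  w 0 * f k + shift 1 ((w ∘ suc) ⋆ f) k
    ≡⟨ cong (w 0 * f k +_) (shift-cong 1 k (λ m _ → ⋆-split c (w ∘ suc) f m)) ⟩
  w 0 * f k + shift 1 (λ m → S m + T m) k
    ≡⟨ cong (w 0 * f k +_) (shift-+ 1 S T k) ⟩
  w 0 * f k + (shift 1 S k + shift 1 T k)
    ≡⟨ cong (λ x → w 0 * f k + (x + shift 1 T k)) (shift-∑ 1 c _ k) ⟩
  w 0 * f k + (∑[ i < c ] shift 1 (shift i (λ m → w (suc i) * f m)) k + shift 1 T k)
    ≡⟨ cong (w 0 * f k +_) (cong₂ _+_ (∑-cong c (λ i _ → shift-shift 1 i _ k)) (shift-shift 1 c _ k)) ⟩
  w 0 * f k + (∑[ i < c ] shift (suc i) (λ m → w (suc i) * f m) k + shift (suc c) ((w ∘ (suc c +_)) ⋆ f) k)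
    ≡⟨ +-assoc (w 0 * f k) _ _ ⟨
  ∑[ i < suc c ] shift i (λ m → w i * f m) k + shift (suc c) ((w ∘ (suc c +_)) ⋆ f) k
    ∎
  where
  S T : ℕ → ℕ
  S m = ∑[ i < c ] shift i (λ m′ → w (suc i) * f m′) m
  T = shift c ((w ∘ (suc c +_)) ⋆ f)

-- the coefficientwise form of (1 − xᵗ) X_{n+1} = (1 + x) X_n
Recurrence : ℕ → (ℕ → ℕ → ℕ) → Set
Recurrence t X = ∀ n k → X (suc n) k ≡ X n k + shift 1 (X n) k + shift t (X (suc n)) k

recurrence-unique : ∀ s {X Y} → Recurrence (suc s) X → Recurrence (suc s) Y →
  (∀ k → X 0 k ≡ Y 0 k) → ∀ n k → X n k ≡ Y n k
recurrence-unique s         recX recY base zero    = base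
recurrence-unique s {X} {Y} recX recY base (suc n) = <-rec _ step
  where
  same : ∀ k → X n k ≡ Y n k
  same = recurrence-unique s recX recY base n

  step : ∀ k → (∀ {m} → m < k → X (suc n) m ≡ Y (suc n) m) → X (suc n) k ≡ Y (suc n) k
  step k earlier = begin
    X (suc n) k                                                 ≡⟨ recX n k ⟩
    X n k + shift 1 (X n) k + shift (suc s) (X (suc n)) k
      ≡⟨ cong₂ _+_ (cong₂ _+_ (same k) (shift-cong 1 k (λ m _ → same m)))
                   (shift-cong< s k (λ m m<k → earlier m<k)) ⟩
    Y n k + shift 1 (Y n) k + shift (suc s) (Y (suc n)) k       ≡⟨ recY n k ⟨
    Y (suc n) k                                                 ∎

allᵇ : ∀ {n} → (ℕ → Bool) → Vec ℕ n → Bool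
allᵇ p = foldr _ (λ a b → p a ∧ b) true

hits : ∀ {n} → (ℕ → Bool) → ℕ → Vec ℕ n → ℕ
hits p k v = iverson ((vsum v ≡ᵇ k) ∧ allᵇ p v)

count : (ℕ → Bool) → ℕ → ℕ → ℕ → ℕ
count p n K k = sum (map (hits p k) (tuplesUpTo n K))

vprod-ones^ : ∀ {n} (v : Vec ℕ n) → vprod (zipWith _^_ (ones n) v) ≡ 1
vprod-ones^ []      = refl
vprod-ones^ (a ∷ v) rewrite ^-zeroˡ a | vprod-ones^ v = refl

M-ones≡count : ∀ s k n → M s k (ones n) ≡ count (admissible s) n k k
M-ones≡count s k n = sum-map-filterᵇ _ _ (tuplesUpTo n k) vprod-ones^

iverson-∧ : ∀ a b c → iverson (a ∧ (b ∧ c)) ≡ iverson b * iverson (a ∧ c)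
iverson-∧ true  true  true  = refl
iverson-∧ true  true  false = refl
iverson-∧ true  false c     = refl
iverson-∧ false true  c     = refl
iverson-∧ false false c     = refl

hits-∷ : ∀ p a {n} (v : Vec ℕ n) k → hits p k (a ∷ v) ≡ iverson (p a) * shift a (λ m → hits p m v) k
hits-∷ p a v k = go a k (p a)
  where
  go : ∀ a k b → iverson ((a + vsum v ≡ᵇ k) ∧ (b ∧ allᵇ p v)) ≡ iverson b * shift a (λ m → hits p m v) k
  go zero    k       b     = iverson-∧ (vsum v ≡ᵇ k) b (allᵇ p v)
  go (suc a) zero    b     = sym (*-zeroʳ (iverson b))
  go (suc a) (suc k) b     = go a k b

count-suc : ∀ p n K k → count p (suc n) K k ≡ ∑[ a < suc K ] (iverson (p a) * shift a (count p n K) k)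
count-suc p n K k = begin
  sum (map (hits p k) (concatMap (λ a → map (a ∷_) T) (upTo (suc K))))
    ≡⟨ sum-map-concatMap (hits p k) (λ a → map (a ∷_) T) (upTo (suc K)) ⟩
  sum (map (λ a → sum (map (hits p k) (map (a ∷_) T))) (upTo (suc K)))
    ≡⟨ cong sum (map-cong firstEntry (upTo (suc K))) ⟩
  sum (map (λ a → iverson (p a) * shift a (count p n K) k) (upTo (suc K)))
    ≡⟨ sum-map-upTo _ (suc K) ⟩
  ∑[ a < suc K ] (iverson (p a) * shift a (count p n K) k) ∎
  where
  T = tuplesUpTo n K

  firstEntry : ∀ a → sum (map (hits p k) (map (a ∷_) T)) ≡ iverson (p a) * shift a (count p n K) k
  firstEntry a = begin
    sum (map (hits p k) (map (a ∷_) T))                           ≡⟨ cong sum (map-∘ T) ⟨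
    sum (map (λ v → hits p k (a ∷ v)) T)
      ≡⟨ cong sum (map-cong (λ v → hits-∷ p a v k) T) ⟩
    sum (map (λ v → iverson (p a) * shift a (λ m → hits p m v) k) T) ≡⟨ sum-map-*ˡ (iverson (p a)) _ T ⟩
    iverson (p a) * sum (map (λ v → shift a (λ m → hits p m v) k) T)
      ≡⟨ cong (iverson (p a) *_) (shift-sum-map a (λ v m → hits p m v) T k) ⟨
    iverson (p a) * shift a (count p n K) k                        ∎

count≡⋆^ : ∀ p n {K k} → k ≤ K → count p n K k ≡ (iverson ∘ p ⋆^ n) k
count≡⋆^ p zero    {k = zero}  _   = refl
count≡⋆^ p zero    {k = suc k} _   = refl
count≡⋆^ p (suc n) {K} {k}     k≤K = begin
  count p (suc n) K k ≡⟨ count-suc p n K k ⟩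
  ∑< (suc K) F
    ≡⟨ ∑-truncate F (s≤s k≤K) (λ a k<a _ →
         trans (cong (iverson (p a) *_) (shift-< a (count p n K) k<a)) (*-zeroʳ (iverson (p a)))) ⟩
  ∑< (suc k) F
    ≡⟨ ∑-cong (suc k) (λ a a<1+k → cong (iverson (p a) *_)
         (trans (shift-≥ a (count p n K) (≤-pred a<1+k)) (count≡⋆^ p n (≤-trans (m∸n≤m k a) k≤K)))) ⟩
  (iverson ∘ p ⋆ iverson ∘ p ⋆^ n) k ∎
  where
  F : ℕ → ℕ
  F a = iverson (p a) * shift a (count p n K) k

admissible-between : ∀ r i → i < r → admissible (suc r) (2 + i) ≡ false
admissible-between r i i<r rewrite m<n⇒m%n≡m {n = 2 + r} (s≤s (s≤s i<r)) = refl

admissible-periodic : ∀ s a → admissible s (suc s + a) ≡ admissible s a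
admissible-periodic s a =
  cong (λ x → (x ≡ᵇ 0) ∨ (x ≡ᵇ 1)) (trans (cong (_% suc s) (+-comm (suc s) a)) ([m+n]%n≡m%n a (suc s)))

-- For s = 1 + r ≥ 1 the residues 0 and 1 are distinct, so on each period the weight is 1, 1, 0, …, 0.
⋆^-admissible-recurrence : ∀ r → Recurrence (2 + r) (λ n → iverson ∘ admissible (suc r) ⋆^ n)
⋆^-admissible-recurrence r n k = begin
  (w ⋆ f) k
    ≡⟨ ⋆-split t w f k ⟩
  (1 * f k + (shift 1 (λ m → 1 * f m) k + between)) + shift t ((w ∘ (t +_)) ⋆ f) k
    ≡⟨ cong₂ _+_ (cong₂ _+_ (*-identityˡ (f k))
                   (cong₂ _+_ (shift-cong 1 k (λ m _ → *-identityˡ (f m))) between≡0))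
                 (shift-cong t k (λ m _ → ∑-cong (suc m) (λ a _ → cong (λ b → iverson b * f (m ∸ a))
                                                                    (admissible-periodic (suc r) a)))) ⟩
  (f k + (shift 1 f k + 0)) + shift t (w ⋆ f) k
    ≡⟨ cong (λ x → f k + x + shift t (w ⋆ f) k) (+-identityʳ _) ⟩
  f k + shift 1 f k + shift t (w ⋆ f) k ∎
  where
  t : ℕ
  t = 2 + r
  w f : ℕ → ℕ
  w = iverson ∘ admissible (suc r)
  f = w ⋆^ n
  between : ℕ
  between = ∑[ i < r ] shift (2 + i) (λ m → w (2 + i) * f m) k
  between≡0 : between ≡ 0
  between≡0 = ∑-truncate {0} _ z≤n (λ i _ i<r →
    trans (shift-cong (2 + i) k (λ m _ → cong (λ b → iverson b * f m) (admissible-between r i i<r)))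
          (shift-zero (2 + i) k))

-- (f ⊙ G) is the product f(x) · G(xᵗ) for t = 1 + s.
module Dilated (s : ℕ) where

  t : ℕ
  t = suc s

  infixl 7 _⊙_

  _⊙_ : (ℕ → ℕ) → (ℕ → ℕ) → ℕ → ℕ
  (f ⊙ G) k = ∑[ j < suc k ] (shift (j * t) f k * G j)

  ⊙-bound : ∀ f G {N} k → suc k ≤ N → ∑[ j < N ] (shift (j * t) f k * G j) ≡ (f ⊙ G) k
  ⊙-bound f G k 1+k≤N = ∑-truncate _ 1+k≤N (λ j k<j _ →
    cong (_* G j) (shift-< (j * t) f (<-≤-trans k<j (m≤m*n j (t)))))

  ⊙-+ˡ : ∀ {f g h} G k → (∀ m → f m ≡ g m + h m) → (f ⊙ G) k ≡ (g ⊙ G) k + (h ⊙ G) k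
  ⊙-+ˡ {f} {g} {h} G k eq = begin
    ∑[ j < suc k ] (shift (j * t) f k * G j)
      ≡⟨ ∑-cong (suc k) (λ j _ → cong (_* G j) (shift-cong (j * t) k (λ m _ → eq m))) ⟩
    ∑[ j < suc k ] (shift (j * t) (λ m → g m + h m) k * G j)
      ≡⟨ ∑-cong (suc k) (λ j _ → trans (cong (_* G j) (shift-+ (j * t) g h k))
                                        (*-distribʳ-+ (G j) (shift (j * t) g k) (shift (j * t) h k))) ⟩
    ∑[ j < suc k ] (shift (j * t) g k * G j + shift (j * t) h k * G j)
      ≡⟨ ∑-distrib-+ (suc k) (λ j → shift (j * t) g k * G j) (λ j → shift (j * t) h k * G j) ⟩
    (g ⊙ G) k + (h ⊙ G) k ∎

  ⊙-+ʳ : ∀ f {G H H′} k → (∀ j → G j ≡ H j + H′ j) → (f ⊙ G) k ≡ (f ⊙ H) k + (f ⊙ H′) k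
  ⊙-+ʳ f {G} {H} {H′} k eq = begin
    ∑[ j < suc k ] (shift (j * t) f k * G j)
      ≡⟨ ∑-cong (suc k) (λ j _ → trans (cong (shift (j * t) f k *_) (eq j))
                                        (*-distribˡ-+ (shift (j * t) f k) (H j) (H′ j))) ⟩
    ∑[ j < suc k ] (shift (j * t) f k * H j + shift (j * t) f k * H′ j)
      ≡⟨ ∑-distrib-+ (suc k) (λ j → shift (j * t) f k * H j) (λ j → shift (j * t) f k * H′ j) ⟩
    (f ⊙ H) k + (f ⊙ H′) k ∎

  ⊙-shiftˡ : ∀ c f G k → (shift c f ⊙ G) k ≡ shift c (f ⊙ G) k
  ⊙-shiftˡ c f G k = begin
    ∑[ j < suc k ] (shift (j * t) (shift c f) k * G j)
      ≡⟨ ∑-cong (suc k) (λ j _ → trans (cong (_* G j) (shift-comm (j * t) c f k))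
                                        (sym (shift-*ʳ c _ (G j) k))) ⟩
    ∑[ j < suc k ] shift c (λ m → shift (j * t) f m * G j) k
      ≡⟨ shift-∑ c (suc k) (λ j m → shift (j * t) f m * G j) k ⟨
    shift c (λ m → ∑[ j < suc k ] (shift (j * t) f m * G j)) k
      ≡⟨ shift-cong c k (λ m c+m≤k → ⊙-bound f G m (s≤s (m+n≤o⇒n≤o c c+m≤k))) ⟩
    shift c (f ⊙ G) k ∎

  ⊙-shiftʳ : ∀ f G k → (f ⊙ shift 1 G) k ≡ shift (t) (f ⊙ G) k
  ⊙-shiftʳ f G k = begin
    f k * 0 + ∑[ j < k ] (shift (t + j * t) f k * G j)
      ≡⟨ cong₂ _+_ (*-zeroʳ (f k))
                   (∑-cong k (λ j _ → trans (cong (_* G j) (sym (shift-shift (t) (j * t) f k)))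
                                            (sym (shift-*ʳ (t) _ (G j) k)))) ⟩
    0 + ∑[ j < k ] shift (t) (λ m → shift (j * t) f m * G j) k
      ≡⟨ shift-∑ (t) k (λ j m → shift (j * t) f m * G j) k ⟨
    shift (t) (λ m → ∑[ j < k ] (shift (j * t) f m * G j)) k
      ≡⟨ shift-cong< s k (λ m m<k → ⊙-bound f G m m<k) ⟩
    shift (t) (f ⊙ G) k ∎

  ⊙-explicit : ∀ f G k → (f ⊙ G) k ≡ ∑[ j < suc (k / t) ] (f (k ∸ j * t) * G j)
  ⊙-explicit f G k = begin
    (f ⊙ G) k
      ≡⟨ ∑-truncate _ (s≤s (m/n≤m k (t))) (λ j q<j _ → cong (_* G j)
           (shift-< (j * t) f (<-≤-trans k<[1+q]t (*-monoˡ-≤ (t) q<j)))) ⟩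
    ∑[ j < suc q ] (shift (j * t) f k * G j)
      ≡⟨ ∑-cong (suc q) (λ j j<1+q → cong (_* G j)
           (shift-≥ (j * t) f (≤-trans (*-monoˡ-≤ (t) (≤-pred j<1+q)) (m/n*n≤m k (t))))) ⟩
    ∑[ j < suc q ] (f (k ∸ j * t) * G j) ∎
    where
    q = k / t
    k<[1+q]t : k < suc q * t
    k<[1+q]t = subst (_< suc q * t) (sym (m≡m%n+[m/n]*n k (t)))
                     (+-monoˡ-< (q * t) (m%n<n k (t)))

C-pascal : ∀ n k → suc n C k ≡ n C k + shift 1 (n C_) k
C-pascal n zero    = refl
C-pascal n (suc k) = trans (sym (nCk+nC[k+1]≡[n+1]C[k+1] n k)) (+-comm (n C k) (n C suc k))

0C≡δ₀ : ∀ k → 0 C k ≡ δ₀ k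
0C≡δ₀ zero    = refl
0C≡δ₀ (suc k) = k>n⇒nCk≡0 {0} {suc k} (s≤s z≤n)

binomShift-suc : ∀ j n → binomShift j (suc n) ≡ (j + n) C n
binomShift-suc zero    n = refl
binomShift-suc (suc j) n = refl

-- the coefficientwise form of (1 − x)⁻⁽ⁿ⁺¹⁾ = (1 − x)⁻ⁿ + x (1 − x)⁻⁽ⁿ⁺¹⁾
binomShift-pascal : ∀ n j →
  binomShift j (suc n) ≡ binomShift j n + shift 1 (λ i → binomShift i (suc n)) j
binomShift-pascal zero    zero          = refl
binomShift-pascal zero    (suc zero)    = refl
binomShift-pascal zero    (suc (suc j)) = refl
binomShift-pascal (suc n) zero          = trans (nCn≡1 (suc n)) (sym (trans (+-identityʳ _) (nCn≡1 n)))
binomShift-pascal (suc n) (suc j)       = begin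
  (suc j + suc n) C suc n                   ≡⟨ cong (λ x → suc x C suc n) (+-suc j n) ⟩
  suc (suc (j + n)) C suc n                 ≡⟨ nCk+nC[k+1]≡[n+1]C[k+1] (suc (j + n)) n ⟨
  suc (j + n) C n + suc (j + n) C suc n     ≡⟨ cong (λ x → suc (j + n) C n + x C suc n) (+-suc j n) ⟨
  suc (j + n) C n + (j + suc n) C suc n     ≡⟨ cong (suc (j + n) C n +_) (binomShift-suc j (suc n)) ⟨
  suc (j + n) C n + binomShift j (suc (suc n)) ∎

module ClosedForm (s : ℕ) where

  open Dilated s

  closedForm : ℕ → ℕ → ℕ
  closedForm n = (n C_) ⊙ (λ j → binomShift j n)

  closedForm-zero : ∀ k → closedForm 0 k ≡ δ₀ k
  closedForm-zero k = begin
    closedForm 0 k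
      ≡⟨ ∑-truncate {N = suc k} (λ j → shift (j * t) (0 C_) k * binomShift j 0) (s≤s z≤n)
                    (λ { (suc j) _ _ → *-zeroʳ (shift (suc j * t) (0 C_) k) }) ⟩
    (0 C k) * 1 + 0
      ≡⟨ trans (+-identityʳ _) (*-identityʳ _) ⟩
    0 C k
      ≡⟨ 0C≡δ₀ k ⟩
    δ₀ k ∎

  closedForm-recurrence : Recurrence (suc s) closedForm
  closedForm-recurrence n k = begin
    closedForm (suc n) k
      ≡⟨ step k ⟩
    R k + shift 1 R k
      ≡⟨ cong₂ _+_ (R-rec k) (trans (shift-cong 1 k (λ m _ → R-rec m)) (shift-+ 1 P (shift t R) k)) ⟩
    P k + shift t R k + (shift 1 P k + shift 1 (shift t R) k)
      ≡⟨ interchange (P k) _ _ _ ⟩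
    P k + shift 1 P k + (shift t R k + shift 1 (shift t R) k)
      ≡⟨ cong (λ x → P k + shift 1 P k + (shift t R k + x)) (shift-comm 1 t R k) ⟩
    P k + shift 1 P k + (shift t R k + shift t (shift 1 R) k)
      ≡⟨ cong (P k + shift 1 P k +_) (trans (shift-cong t k (λ m _ → step m))
                                            (shift-+ t R (shift 1 R) k)) ⟨
    P k + shift 1 P k + shift t (closedForm (suc n)) k ∎
    where
    P R : ℕ → ℕ
    P = closedForm n
    R = (n C_) ⊙ (λ j → binomShift j (suc n))

    R-rec : ∀ k → R k ≡ P k + shift t R k
    R-rec k = trans (⊙-+ʳ (n C_) {H = λ j → binomShift j n} k (binomShift-pascal n))
                    (cong (P k +_) (⊙-shiftʳ (n C_) (λ j → binomShift j (suc n)) k))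

    step : ∀ k → closedForm (suc n) k ≡ R k + shift 1 R k
    step k = trans (⊙-+ˡ {g = n C_} (λ j → binomShift j (suc n)) k (C-pascal n))
                   (cong (R k +_) (⊙-shiftˡ 1 (n C_) (λ j → binomShift j (suc n)) k))

theorem3p3 : (n k s : ℕ) → 1 ≤ s →
    M s k (ones n) ≡ sumTo (k / suc s) (λ j → (n C (k ∸ j * suc s)) * binomShift j n)
theorem3p3 n k s@(suc r) _ = begin
  M s k (ones n)                      ≡⟨ M-ones≡count s k n ⟩
  count (admissible s) n k k          ≡⟨ count≡⋆^ (admissible s) n ≤-refl ⟩
  (iverson ∘ admissible s ⋆^ n) k     ≡⟨ recurrence-unique s (⋆^-admissible-recurrence r) closedForm-recurrence
                                           (sym ∘ closedForm-zero) n k ⟩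
  closedForm n k                      ≡⟨ Dilated.⊙-explicit s (n C_) (λ j → binomShift j n) k ⟩
  ∑[ j < suc (k / suc s) ] ((n C (k ∸ j * suc s)) * binomShift j n)
                                      ≡⟨ sum-map-upTo _ (suc (k / suc s)) ⟨
  sumTo (k / suc s) (λ j → (n C (k ∸ j * suc s)) * binomShift j n) ∎
  where open ClosedForm s
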